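{- Let $n,k$ be integers with $1\le k\le n$. Then \[ \sigma(k)-\sigma(n)+\#([n]\cap[n-k]) \ge 0 \quad\text{and}\quad \sigma(k-1)-\sigma(n-1)+\#([n-1]\cap[n-k])\ge 0, \] i.e., the almost minimum zero estimate and the shifted almost minimum zero estimate for $\nu(S(n,k))$ are non-negative.
   Context: For a nonnegative integer $m$, $\sigma(m)$ is the sum of the base-$2$ digits of $m$ and $[m]$ is the set of powers of $2$ occurring in the base-$2$ expansion of $m$. For the Stirling number of the second kind $S(n,k)$ and $2$-adic valuation $\nu$, the almost minimum zero estimate is $\nu(S(n,k))\ge \sigma(k)-\sigma(n)+\#([n]\cap[n-k])$ and the shifted almost minimum zero estimate is $\nu(S(n,k))\ge \sigma(k-1)-\sigma(n-1)+\#([n-1]\cap[n-k])$. -}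

module Defs where

open import Data.Nat using (ℕ; zero; suc; _+_; _^_; _≡ᵇ_)
open import Data.Nat.DivMod using (_/_; _%_)
open import Data.Bool using (Bool; true; false; _∧_; if_then_else_)

-- The i-th base-2 digit of m is 1 iff 2^i ∈ [m].
bitSet : ℕ → ℕ → Bool
bitSet m zero    = (m % 2) ≡ᵇ 1
bitSet m (suc i) = bitSet (m / 2) i

countBelow : ℕ → (ℕ → Bool) → ℕ
countBelow zero    p = 0
countBelow (suc b) p = countBelow b p + (if p b then 1 else 0)

-- σ(m): sum of base-2 digits of m.  Every exponent i with 2^i ≤ m satisfies i < m+1,
-- so counting i < suc m covers all digits.
σ : ℕ → ℕ
σ m = countBelow (suc m) (bitSet m)

#∩ : ℕ → ℕ → ℕ
#∩ m m' = countBelow (suc (m + m')) (λ i → bitSet m i ∧ bitSet m' i)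

{-# OPTIONS --safe #-}
-- Add k and m = n ∸ k in base 2 with carries cᵢ ∈ {0, 1}, c₀ = 0.  At every position
-- nᵢ + cᵢ₊₁ ≤ cᵢ + kᵢ + (nᵢ ∧ mᵢ), a finite check on a full adder; summing over the
-- positions the carries telescope, so σ(n) ≤ σ(k) + #([n] ∩ [m]).  The shifted estimate
-- is the same inequality for n − 1 = (k − 1) + m.
module Submission where

open import Defs
open import Data.Nat using (ℕ; _≤_; _∸_)
open import Data.Product using (_×_; _,_)
open import Data.Integer using (ℤ; +_; _+_; _-_; _≥_)

open import Data.Bool using (Bool; false; _∧_; if_then_else_)
open import Data.Nat as ℕ using (zero; suc; _*_; _<_; _≡ᵇ_; z≤n; s≤s; NonZero)
open import Data.Nat.DivMod
open import Data.Nat.Divisibility using (divides-refl)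
open import Data.Nat.Properties
open import Data.Nat.Solver using (module +-*-Solver)
open import Data.Sum using (inj₁; inj₂)
open import Data.Unit using (tt)
open import Relation.Binary.PropositionalEquality
import Data.Integer.Properties as ℤ

open +-*-Solver using (solve; _:=_; _:+_; _:*_; con)

bit : Bool → ℕ
bit b = if b then 1 else 0

countBelow-suc : ∀ b p → countBelow (suc b) p ≡ bit (p 0) ℕ.+ countBelow b (λ i → p (suc i))
countBelow-suc zero    p = sym (+-identityʳ _)
countBelow-suc (suc b) p rewrite countBelow-suc b p = +-assoc (bit (p 0)) _ _

countBelow-mono : ∀ {b b'} p → b ≤ b' → countBelow b p ≤ countBelow b' p
countBelow-mono {b' = zero}   p z≤n = ≤-refl
countBelow-mono {b' = suc b'} p b≤b' with m≤n⇒m<n∨m≡n b≤b'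
... | inj₁ (s≤s b≤b'') = ≤-trans (countBelow-mono p b≤b'') (m≤m+n _ _)
... | inj₂ refl        = ≤-refl

countBelow-vanishing : ∀ {b b'} p → (∀ i → b ≤ i → p i ≡ false) →
                       b ≤ b' → countBelow b' p ≡ countBelow b p
countBelow-vanishing {b' = zero}   p _ z≤n = refl
countBelow-vanishing {b' = suc b'} p p≡false b≤b' with m≤n⇒m<n∨m≡n b≤b'
... | inj₂ refl = refl
... | inj₁ (s≤s b≤b'')
  rewrite p≡false b' b≤b'' | countBelow-vanishing p p≡false b≤b'' = +-identityʳ _

bitSet-≥ : ∀ {m} i → m ≤ i → bitSet m i ≡ false
bitSet-≥ zero    z≤n = refl
bitSet-≥ {m} (suc i) m≤1+i = bitSet-≥ i (≤-pred (begin-strict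
  m / 2      ≤⟨ /-monoˡ-≤ 2 m≤1+i ⟩
  suc i / 2  <⟨ m/n<m (suc i) 2 (s≤s (s≤s z≤n)) ⟩
  suc i      ∎))
  where open ≤-Reasoning

[m+kn]/n≡m/n+k : ∀ m k n .{{_ : NonZero n}} → (m ℕ.+ k * n) / n ≡ m / n ℕ.+ k
[m+kn]/n≡m/n+k m k n =
  trans (+-distrib-/-∣ʳ m (divides-refl k)) (cong (m / n ℕ.+_) (m*n/n≡m k n))

-- t / 2 is the carry out of the lowest digit of c + k + m.
module HalfAdder (c k m : ℕ) where

  t : ℕ
  t = c ℕ.+ k % 2 ℕ.+ m % 2

  sum≡ : c ℕ.+ k ℕ.+ m ≡ t ℕ.+ (k / 2 ℕ.+ m / 2) * 2
  sum≡ = begin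
    c ℕ.+ k ℕ.+ m
      ≡⟨ cong₂ (λ x y → c ℕ.+ x ℕ.+ y) (m≡m%n+[m/n]*n k 2) (m≡m%n+[m/n]*n m 2) ⟩
    c ℕ.+ (k % 2 ℕ.+ k / 2 * 2) ℕ.+ (m % 2 ℕ.+ m / 2 * 2)
      ≡⟨ solve 5 (λ c a k' e m' → c :+ (a :+ k' :* con 2) :+ (e :+ m' :* con 2)
                                := c :+ a :+ e :+ (k' :+ m') :* con 2)
               refl c (k % 2) (k / 2) (m % 2) (m / 2) ⟩
    t ℕ.+ (k / 2 ℕ.+ m / 2) * 2 ∎
    where open ≡-Reasoning

  low≡ : (c ℕ.+ k ℕ.+ m) % 2 ≡ t % 2
  low≡ = trans (cong (_% 2) sum≡) ([m+kn]%n≡m%n t (k / 2 ℕ.+ m / 2) 2)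

  high≡ : (c ℕ.+ k ℕ.+ m) / 2 ≡ t / 2 ℕ.+ k / 2 ℕ.+ m / 2
  high≡ = trans (cong (_/ 2) sum≡)
                (trans ([m+kn]/n≡m/n+k t (k / 2 ℕ.+ m / 2) 2) (sym (+-assoc (t / 2) _ _)))

  carry≤1 : c ≤ 1 → t / 2 ≤ 1
  carry≤1 c≤1 = ≤-pred (m<n*o⇒m/o<n {t} {2} {2}
    (s≤s (+-mono-≤ (+-mono-≤ c≤1 (≤-pred (m%n<n k 2))) (≤-pred (m%n<n m 2)))))

fullAdder-bound : ∀ c a e → c ≤ 1 → a < 2 → e < 2 →
  let t = c ℕ.+ a ℕ.+ e in
  bit (t % 2 ≡ᵇ 1) ℕ.+ t / 2 ≤ c ℕ.+ bit (a ≡ᵇ 1) ℕ.+ bit ((t % 2 ≡ᵇ 1) ∧ (e ≡ᵇ 1))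
fullAdder-bound 0 0 0 _ _ _ = ≤ᵇ⇒≤ _ _ tt
fullAdder-bound 0 0 1 _ _ _ = ≤ᵇ⇒≤ _ _ tt
fullAdder-bound 0 1 0 _ _ _ = ≤ᵇ⇒≤ _ _ tt
fullAdder-bound 0 1 1 _ _ _ = ≤ᵇ⇒≤ _ _ tt
fullAdder-bound 1 0 0 _ _ _ = ≤ᵇ⇒≤ _ _ tt
fullAdder-bound 1 0 1 _ _ _ = ≤ᵇ⇒≤ _ _ tt
fullAdder-bound 1 1 0 _ _ _ = ≤ᵇ⇒≤ _ _ tt
fullAdder-bound 1 1 1 _ _ _ = ≤ᵇ⇒≤ _ _ tt
fullAdder-bound (suc (suc _)) _ _ (s≤s ()) _ _
fullAdder-bound _ (suc (suc _)) _ _ (s≤s (s≤s ())) _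
fullAdder-bound _ _ (suc (suc _)) _ _ (s≤s (s≤s ()))

onesBelow : ℕ → ℕ → ℕ
onesBelow b m = countBelow b (bitSet m)

commonOnesBelow : ℕ → ℕ → ℕ → ℕ
commonOnesBelow b m m' = countBelow b (λ i → bitSet m i ∧ bitSet m' i)

onesBelow-add : ∀ b {c k m n} → c ≤ 1 → n ≡ c ℕ.+ k ℕ.+ m →
  onesBelow b n ≤ c ℕ.+ onesBelow b k ℕ.+ commonOnesBelow b n m
onesBelow-add zero    _   _    = z≤n
onesBelow-add (suc b) {c} {k} {m} c≤1 refl = begin
  onesBelow (suc b) n
    ≡⟨ countBelow-suc b (bitSet n) ⟩
  bit n₀ ℕ.+ onesBelow b (n / 2)
    ≤⟨ +-monoʳ-≤ (bit n₀) (onesBelow-add b (carry≤1 c≤1) high≡) ⟩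
  bit n₀ ℕ.+ (t / 2 ℕ.+ K ℕ.+ M)
    ≡⟨ solve 4 (λ d c' K M → d :+ (c' :+ K :+ M) := d :+ c' :+ (K :+ M))
             refl (bit n₀) (t / 2) K M ⟩
  bit n₀ ℕ.+ t / 2 ℕ.+ (K ℕ.+ M)
    ≤⟨ +-monoˡ-≤ (K ℕ.+ M) digit ⟩
  c ℕ.+ bit k₀ ℕ.+ bit (n₀ ∧ m₀) ℕ.+ (K ℕ.+ M)
    ≡⟨ solve 5 (λ c a d K M → c :+ a :+ d :+ (K :+ M) := c :+ (a :+ K) :+ (d :+ M))
             refl c (bit k₀) (bit (n₀ ∧ m₀)) K M ⟩
  c ℕ.+ (bit k₀ ℕ.+ K) ℕ.+ (bit (n₀ ∧ m₀) ℕ.+ M)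
    ≡⟨ sym (cong₂ (λ x y → c ℕ.+ x ℕ.+ y)
                  (countBelow-suc b (bitSet k))
                  (countBelow-suc b (λ i → bitSet n i ∧ bitSet m i))) ⟩
  c ℕ.+ onesBelow (suc b) k ℕ.+ commonOnesBelow (suc b) n m ∎
  where
  open ≤-Reasoning
  open HalfAdder c k m
  n  = c ℕ.+ k ℕ.+ m
  n₀ = bitSet n 0
  k₀ = bitSet k 0
  m₀ = bitSet m 0
  K  = onesBelow b (k / 2)
  M  = commonOnesBelow b (n / 2) (m / 2)
  digit : bit n₀ ℕ.+ t / 2 ≤ c ℕ.+ bit k₀ ℕ.+ bit (n₀ ∧ m₀)
  digit rewrite low≡ = fullAdder-bound c (k % 2) (m % 2) c≤1 (m%n<n k 2) (m%n<n m 2)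

σ-onesBelow : ∀ {b} k → k < b → onesBelow b k ≡ σ k
σ-onesBelow k k<b =
  countBelow-vanishing (bitSet k) (λ i k<i → bitSet-≥ i (<⇒≤ k<i)) k<b

σ[k+m]≤σ[k]+#∩ : ∀ k m → σ (k ℕ.+ m) ≤ σ k ℕ.+ #∩ (k ℕ.+ m) m
σ[k+m]≤σ[k]+#∩ k m = begin
  σ n                                ≤⟨ countBelow-mono (bitSet n) (s≤s (m≤m+n n m)) ⟩
  onesBelow b n                      ≤⟨ onesBelow-add b z≤n refl ⟩
  onesBelow b k ℕ.+ #∩ n m           ≡⟨ cong (ℕ._+ #∩ n m) (σ-onesBelow k (s≤s k≤b)) ⟩
  σ k ℕ.+ #∩ n m                     ∎
  where
  open ≤-Reasoning
  n = k ℕ.+ m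
  b = suc (n ℕ.+ m)
  k≤b : k ≤ n ℕ.+ m
  k≤b = ≤-trans (m≤m+n k m) (m≤m+n n m)

σ[n]≤σ[k]+#∩ : ∀ {n k} → k ≤ n → σ n ≤ σ k ℕ.+ #∩ n (n ∸ k)
σ[n]≤σ[k]+#∩ {n} {k} k≤n =
  subst (λ x → σ x ≤ σ k ℕ.+ #∩ x (n ∸ k)) (m+[n∸m]≡n k≤n) (σ[k+m]≤σ[k]+#∩ k (n ∸ k))

m-n+o≥0 : ∀ {m n o} → n ≤ m ℕ.+ o → (+ m) - (+ n) + (+ o) ≥ + 0
m-n+o≥0 {m} {n} {o} n≤m+o = subst (_≥ + 0) (sym m-n+o≡m+o∸n) (Data.Integer.+≤+ z≤n)
  where
  m-n+o≡m+o∸n : (+ m) - (+ n) + (+ o) ≡ + (m ℕ.+ o ∸ n)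
  m-n+o≡m+o∸n = trans (cong (_+ (+ o)) (ℤ.[+m]-[+n]≡m⊖n m n))
                      (trans (ℤ.distribˡ-⊖-+-pos o m n) (ℤ.⊖-≥ n≤m+o))

theorem3p1 : (n k : ℕ) → 1 ≤ k → k ≤ n →
    ((+ σ k) - (+ σ n) + (+ #∩ n (n ∸ k)) ≥ + 0)
    × ((+ σ (k ∸ 1)) - (+ σ (n ∸ 1)) + (+ #∩ (n ∸ 1) (n ∸ k)) ≥ + 0)
theorem3p1 (suc n) (suc k) _ (s≤s k≤n) =
  m-n+o≥0 (σ[n]≤σ[k]+#∩ (s≤s k≤n)) , m-n+o≥0 (σ[n]≤σ[k]+#∩ k≤n)
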